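{- Let $n$ be an even positive integer and let $m=\lceil\log_2 n\rceil-1$, so that $2^m<n\leq 2^{m+1}$. (1) $\|n\|_2=m+1$ if and only if $n=2^{m+1}$ or $n=2^m+2^{m'}$ for some integer $m'$ with $1\leq m'<m$. (2) $\|n\|_2=m+2$ if and only if $n$ is of one of the following forms: (a) $2^{m_1}+2^{m_2}+2^{m_3}$ with integers $m=m_1>m_2>m_3\geq 1$; (b) $2^{m_1}+2^{m_2}+2^{m_3}+2^{m_4}$ with integers $m=m_1>m_2>m_3>m_4\geq 2$ and $m_1+m_4=m_2+m_3$; (c) $2^{m_1}+2^{m_1-3}+2^{m_2}+2^{m_2-1}$ with integers $m=m_1\geq m_2+3\geq 6$; (d) $2^m+2^{m-5}+2^{m-6}+2^{m-7}$ with $m\geq 10$.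
   Context: For a positive integer $l$ and $n\in l\mathbb{Z}^+$, the $l$-complexity $\|n\|_l$ is the minimal number of copies of $l$ needed to express $n$ from $l$ using only addition and multiplication (and parentheses). Equivalently, $\|l\|_l=1$ and $\|n\|_l=\min(\|a\|_l+\|b\|_l)$, the minimum over $a,b\in l\mathbb{Z}^+$ with $a+b=n$ or $ab=n$. Here $l=2$. -}

module Defs where

open import Data.Nat using (ℕ; _+_; _*_; _≤_; _<_)
open import Data.Product using (Σ; _×_)
open import Relation.Binary.PropositionalEquality using (_≡_)

-- Arithmetic expressions built from copies of the constant l = 2
-- using only addition and multiplication (parentheses = tree structure).
data Expr : Set where
  two  : Expr
  _⊕_  : Expr → Expr → Expr
  _⊗_  : Expr → Expr → Expr

eval : Expr → ℕ
eval two     = 2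
eval (e ⊕ f) = eval e + eval f
eval (e ⊗ f) = eval e * eval f

copies : Expr → ℕ
copies two     = 1
copies (e ⊕ f) = copies e + copies f
copies (e ⊗ f) = copies e + copies f

‖_‖₂≡_ : ℕ → ℕ → Set
‖ n ‖₂≡ k =
  Σ Expr (λ e → eval e ≡ n × copies e ≡ k)
  × ((e : Expr) → eval e ≡ n → k ≤ copies e)

{-# OPTIONS --safe #-}
module Submission where

-- An expression with k copies of 2 has value at most 2^k, since a + b ≤ a b for
-- a, b ≥ 2; hence ‖n‖₂ ≥ m + 1. Call k copies reaching v efficient when 2^k < 4 v.
-- Subexpressions of an efficient expression are efficient, and an efficient sum has
-- a summand 2 or 4, so by induction every efficient value is 2^t times the odd part
-- of one of a few families of shapes; whether the product of two shapes stays
-- efficient is decided by comparing 2^cost with twice the odd part. For k = m + 1 and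
-- k = m + 2 and 2^m < n ≤ 2^(m+1) the surviving shapes are exactly the listed forms.
-- Conversely each form is the value of an explicit expression, and no form of (2) is
-- a form of (1), because n − 2^m then lies strictly between two powers of two.

open import Defs
open import Data.Nat using (ℕ; _+_; _∸_; _^_; _≤_; _<_)
open import Data.Nat.Divisibility using (_∣_)
open import Data.Product using (Σ; _×_)
open import Data.Sum using (_⊎_)
open import Function.Bundles using (_⇔_)
open import Relation.Binary.PropositionalEquality using (_≡_)

open import Data.Nat
open import Data.Nat.Properties
open import Data.Nat.Tactic.RingSolver using (solve-∀)
open import Algebra.Properties.CommutativeSemigroup *-commutativeSemigroup using (x∙yz≈y∙xz)
open import Algebra.Properties.CommutativeSemigroup +-commutativeSemigroup
  using () renaming (interchange to +-interchange)
open import Data.Product using (∃; _,_)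
open import Data.Sum using (inj₁; inj₂; [_,_]′)
open import Function using (id; _$_)
open import Function.Bundles using (mk⇔)
open import Relation.Nullary using (¬_; yes; no; contradiction)
open import Relation.Binary.PropositionalEquality
  using (_≢_; refl; sym; trans; cong; cong₂; subst; subst₂; module ≡-Reasoning)

-- An inequality between polynomials with natural coefficients holds at positive
-- arguments once, after the shift X = 1 + x, the difference D has natural
-- coefficients; the ring solver checks the shifted identity.
positive-≤₁ : (L R D : ℕ → ℕ) → (∀ x → L (suc x) + D x ≡ R (suc x)) →
              ∀ {X} → 0 < X → L X ≤ R X
positive-≤₁ L R D identity {suc x} _ = subst (L (suc x) ≤_) (identity x) (m≤m+n _ _)

positive-≤₂ : (L R D : ℕ → ℕ → ℕ) →
              (∀ x y → L (suc x) (suc y) + D x y ≡ R (suc x) (suc y)) →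
              ∀ {X Y} → 0 < X → 0 < Y → L X Y ≤ R X Y
positive-≤₂ L R D identity {suc x} {suc y} _ _ = subst (L (suc x) (suc y) ≤_) (identity x y) (m≤m+n _ _)

2^>0 : ∀ x → 0 < 2 ^ x
2^>0 = m^n>0 2

2^-cancel-< : ∀ m n → 2 ^ m < 2 ^ n → m < n
2^-cancel-< m n lt = ≰⇒> (λ n≤m → <⇒≱ lt (^-monoʳ-≤ 2 n≤m))

2^suc≡ : ∀ u → 2 ^ suc u ≡ 2 ^ u + 2 ^ u
2^suc≡ u = cong (2 ^ u +_) (+-identityʳ (2 ^ u))

2^-+₃ : ∀ a b c → 2 ^ (a + b + c) ≡ 2 ^ a * 2 ^ b * 2 ^ c
2^-+₃ a b c = trans (^-distribˡ-+-* 2 (a + b) c) (cong (_* 2 ^ c) (^-distribˡ-+-* 2 a b))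

2^-+₄ : ∀ a b c d → 2 ^ (a + b + c + d) ≡ 2 ^ a * 2 ^ b * 2 ^ c * 2 ^ d
2^-+₄ a b c d = trans (^-distribˡ-+-* 2 (a + b + c) d) (cong (_* 2 ^ d) (2^-+₃ a b c))

+≤* : ∀ {a b} → 2 ≤ a → 2 ≤ b → a + b ≤ a * b
+≤* {suc (suc a)} {suc (suc b)} (s≤s (s≤s z≤n)) (s≤s (s≤s z≤n)) =
  subst (2 + a + (2 + b) ≤_) (identity a b) (m≤m+n _ _)
  where
  identity : ∀ a b → 2 + a + (2 + b) + (a + b + a * b) ≡ (2 + a) * (2 + b)
  identity = solve-∀

4+n≤2*[2+n] : ∀ n → 4 + n ≤ 2 * (2 + n)
4+n≤2*[2+n] n = subst (4 + n ≤_) (identity n) (m≤m+n (4 + n) n)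
  where
  identity : ∀ n → 4 + n + n ≡ 2 * (2 + n)
  identity = solve-∀

<⇒≡+suc : ∀ {i m} → i < m → ∃ λ a → m ≡ i + suc a
<⇒≡+suc {i} i<m with m≤n⇒∃[o]m+o≡n i<m
... | a , refl = a , sym (+-suc i a)

+-cancel-middle : ∀ a b c d → a + b + c ≡ a + (c + d) → b ≡ d
+-cancel-middle a b c d eq =
  +-cancelʳ-≡ c b d (trans (+-cancelˡ-≡ a (b + c) (c + d) (trans (sym (+-assoc a b c)) eq)) (+-comm c d))

-- Expressions and efficiency

copies-pos : ∀ e → 0 < copies e
copies-pos two     = z<s
copies-pos (e ⊕ f) = ≤-trans (copies-pos e) (m≤m+n _ _)
copies-pos (e ⊗ f) = ≤-trans (copies-pos e) (m≤m+n _ _)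

eval≥2 : ∀ e → 2 ≤ eval e
eval≥2 two     = ≤-refl
eval≥2 (e ⊕ f) = ≤-trans (eval≥2 e) (m≤m+n _ _)
eval≥2 (e ⊗ f) = *-mono-≤ (eval≥2 e) (≤-trans (s≤s z≤n) (eval≥2 f))

eval≤2^copies : ∀ e → eval e ≤ 2 ^ copies e
eval≤2^copies two     = ≤-refl
eval≤2^copies (e ⊕ f) = begin
  eval e + eval f              ≤⟨ +-mono-≤ (eval≤2^copies e) (eval≤2^copies f) ⟩
  2 ^ copies e + 2 ^ copies f  ≤⟨ +≤* (^-monoʳ-≤ 2 (copies-pos e)) (^-monoʳ-≤ 2 (copies-pos f)) ⟩
  2 ^ copies e * 2 ^ copies f  ≡⟨ ^-distribˡ-+-* 2 (copies e) (copies f) ⟨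
  2 ^ (copies e + copies f)    ∎
  where open ≤-Reasoning
eval≤2^copies (e ⊗ f) = begin
  eval e * eval f              ≤⟨ *-mono-≤ (eval≤2^copies e) (eval≤2^copies f) ⟩
  2 ^ copies e * 2 ^ copies f  ≡⟨ ^-distribˡ-+-* 2 (copies e) (copies f) ⟨
  2 ^ (copies e + copies f)    ∎
  where open ≤-Reasoning

copies-lower-bound : ∀ {m} e → 2 ^ m < eval e → m + 1 ≤ copies e
copies-lower-bound {m} e lt =
  subst (_≤ copies e) (+-comm 1 m) (2^-cancel-< m (copies e) (<-≤-trans lt (eval≤2^copies e)))

data Size (k v : ℕ) : Set where
  single : k ≡ 1 → v ≡ 2 → Size k v
  double : k ≡ 2 → v ≡ 4 → Size k v
  large  : 3 ≤ k → Size k v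

size-node : ∀ {k l v w u} → 0 < l → (v ≡ 2 → w ≡ 2 → u ≡ 4) →
            Size k v → Size l w → Size (k + l) u
size-node _   op (single refl v≡2) (single refl w≡2) = double refl (op v≡2 w≡2)
size-node _   _  (single refl _)   (double refl _)   = large ≤-refl
size-node _   _  (single refl _)   (large 3≤l)       = large (m≤n⇒m≤1+n 3≤l)
size-node l>0 _  (double refl _)   _                 = large (s≤s (s≤s l>0))
size-node _   _  (large 3≤k)       _                 = large (≤-trans 3≤k (m≤m+n _ _))

size : ∀ e → Size (copies e) (eval e)
size two     = single refl refl
size (e ⊕ f) = size-node (copies-pos f) (cong₂ _+_) (size e) (size f)
size (e ⊗ f) = size-node (copies-pos f) (cong₂ _*_) (size e) (size f)

-- k < log₂ v + 2: within two copies of the trivial lower bound.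
Efficient : ℕ → ℕ → Set
Efficient k v = 2 ^ k < 4 * v

efficient-below : ∀ {m n} j → j ≤ 2 → 2 ^ m < n → Efficient (m + j) n
efficient-below {m} {n} j j≤2 lo = begin-strict
  2 ^ (m + j)    ≡⟨ ^-distribˡ-+-* 2 m j ⟩
  2 ^ m * 2 ^ j  <⟨ *-monoˡ-< (2 ^ j) {{m^n≢0 2 j}} lo ⟩
  n * 2 ^ j      ≤⟨ *-monoʳ-≤ n (^-monoʳ-≤ 2 j≤2) ⟩
  n * 4          ≡⟨ *-comm n 4 ⟩
  4 * n          ∎
  where open ≤-Reasoning

efficient-*ˡ : ∀ {k l v w} → w ≤ 2 ^ l → Efficient (k + l) (v * w) → Efficient k v
efficient-*ˡ {k} {l} {v} {w} w≤2^l eff = ≰⇒> λ 4v≤2^k → <⇒≱ eff (begin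
  4 * (v * w)    ≡⟨ *-assoc 4 v w ⟨
  4 * v * w      ≤⟨ *-mono-≤ 4v≤2^k w≤2^l ⟩
  2 ^ k * 2 ^ l  ≡⟨ ^-distribˡ-+-* 2 k l ⟨
  2 ^ (k + l)    ∎)
  where open ≤-Reasoning

efficient-*ʳ : ∀ {k l v w} → v ≤ 2 ^ k → Efficient (k + l) (v * w) → Efficient l w
efficient-*ʳ {k} {l} {v} {w} v≤2^k eff =
  efficient-*ˡ {l} {k} {w} {v} v≤2^k (subst₂ Efficient (+-comm k l) (*-comm v w) eff)

efficient-scale : ∀ t {k v} → Efficient (t + k) (2 ^ t * v) → Efficient k v
efficient-scale t {k} {v} eff = *-cancelˡ-< (2 ^ t) _ _ (begin-strict
  2 ^ t * 2 ^ k    ≡⟨ ^-distribˡ-+-* 2 t k ⟨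
  2 ^ (t + k)      <⟨ eff ⟩
  4 * (2 ^ t * v)  ≡⟨ x∙yz≈y∙xz 4 (2 ^ t) v ⟩
  2 ^ t * (4 * v)  ∎)
  where open ≤-Reasoning

efficient-+ : ∀ {j k v} → 0 < j → 2 ≤ v → Efficient (j + k) (2 ^ j + v) → Efficient k v
efficient-+ {j} {k} {v} j>0 v≥2 eff = efficient-scale j (begin-strict
  2 ^ (j + k)      <⟨ eff ⟩
  4 * (2 ^ j + v)  ≤⟨ *-monoʳ-≤ 4 (+≤* (^-monoʳ-≤ 2 j>0) v≥2) ⟩
  4 * (2 ^ j * v)  ∎)
  where open ≤-Reasoning

¬efficient-+ : ∀ {k l v w} → 3 ≤ k → 3 ≤ l → v ≤ 2 ^ k → w ≤ 2 ^ l →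
               ¬ Efficient (k + l) (v + w)
¬efficient-+ {suc (suc (suc k))} {suc (suc (suc l))} {v} {w} (s≤s (s≤s (s≤s _))) (s≤s (s≤s (s≤s _)))
             v≤2^k w≤2^l eff = <⇒≱ eff (begin
  4 * (v + w)                          ≤⟨ *-monoʳ-≤ 4 (+-mono-≤ v≤2^k w≤2^l) ⟩
  4 * (2 ^ (3 + k) + 2 ^ (3 + l))      ≤⟨ positive-≤₂ (λ K L → 4 * (2 * (2 * (2 * K)) + 2 * (2 * (2 * L))))
                                                      (λ K L → 2 * (2 * (2 * K)) * (2 * (2 * (2 * L))))
                                                      (λ k l → 32 * k + 32 * l + 64 * k * l)
                                                      solve-∀ (2^>0 k) (2^>0 l) ⟩
  2 ^ (3 + k) * 2 ^ (3 + l)            ≡⟨ ^-distribˡ-+-* 2 (3 + k) (3 + l) ⟨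
  2 ^ (3 + k + (3 + l))                ∎)
  where open ≤-Reasoning

¬efficient-2+ : ∀ k v → 2 * (2 + v) ≤ 2 ^ k → ¬ Efficient (1 + k) (2 + v)
¬efficient-2+ k v bound eff =
  <⇒≱ eff (subst (_≤ 2 * 2 ^ k) (sym (*-assoc 2 2 (2 + v))) (*-monoʳ-≤ 2 bound))

¬efficient-4+ : ∀ k v → 4 + v ≤ 2 ^ k → ¬ Efficient (2 + k) (4 + v)
¬efficient-4+ k v bound eff =
  <⇒≱ eff (subst (4 * (4 + v) ≤_) (*-assoc 2 2 (2 ^ k)) (*-monoʳ-≤ 4 bound))

-- Shapes

-- A shape stands for the numbers 2^(1+s) · oddPart sh reached with 1 + s + cost sh
-- copies of 2 (see Shaped); a primed shape spends one copy more than its unprimed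
-- twin. formA, formB, formC and formD have the odd parts of the families (a)–(d),
-- e.g. 3 (3 · 2^(1+x) + 1) = 2^(x+4) + 2^(x+1) + 2 + 1 and 135 = 2^7 + 2^2 + 2 + 1.
data Shape : Set where
  pow pow⁺ formD  : Shape
  bin bin⁺ formC  : ℕ → Shape
  formA formB     : ℕ → ℕ → Shape

oddPart : Shape → ℕ
oddPart pow         = 1
oddPart pow⁺        = 1
oddPart (bin a)     = 2 ^ suc a + 1
oddPart (bin⁺ a)    = 2 ^ suc a + 1
oddPart (formA x y) = 2 ^ suc x * 2 ^ suc y + 2 ^ suc x + 1
oddPart (formB x y) = (2 ^ suc x * 2 ^ suc y + 1) * (2 ^ suc x + 1)
oddPart (formC x)   = 3 * (3 * 2 ^ suc x + 1)
oddPart formD       = 135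

cost : Shape → ℕ
cost pow         = 0
cost pow⁺        = 1
cost (bin a)     = 2 + a
cost (bin⁺ a)    = 3 + a
cost (formA x y) = 4 + (x + y)
cost (formB x y) = 5 + (x + (x + y))
cost (formC x)   = 6 + x
cost formD       = 9

-- formB, formC and formD only ever occur multiplied by 4, 4 and 8 respectively.
minTwos : Shape → ℕ
minTwos (formB _ _) = 2
minTwos (formC _)   = 2
minTwos formD       = 3
minTwos _           = 1

record Shaped (k v : ℕ) : Set where
  constructor shaped
  field
    s           : ℕ
    shape       : Shape
    enough-twos : minTwos shape ≤ suc s
    value-≡     : v ≡ 2 ^ suc s * oddPart shape
    copies-≡    : k ≡ suc s + cost shape

2^cost-formA : ∀ x y → 2 ^ cost (formA x y) ≡ 16 * (2 ^ x * 2 ^ y)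
2^cost-formA x y = trans (times16 (2 ^ (x + y))) (cong (16 *_) (^-distribˡ-+-* 2 x y))
  where
  times16 : ∀ P → 2 * (2 * (2 * (2 * P))) ≡ 16 * P
  times16 = solve-∀

2^cost-formB : ∀ x y → 2 ^ cost (formB x y) ≡ 32 * (2 ^ x * (2 ^ x * 2 ^ y))
2^cost-formB x y = begin
  2 * (2 * (2 * (2 * (2 * 2 ^ (x + (x + y))))))  ≡⟨ times32 (2 ^ (x + (x + y))) ⟩
  32 * 2 ^ (x + (x + y))                          ≡⟨ cong (32 *_) (^-distribˡ-+-* 2 x (x + y)) ⟩
  32 * (2 ^ x * 2 ^ (x + y))                      ≡⟨ cong (λ P → 32 * (2 ^ x * P)) (^-distribˡ-+-* 2 x y) ⟩
  32 * (2 ^ x * (2 ^ x * 2 ^ y))                  ∎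
  where
  open ≡-Reasoning
  times32 : ∀ P → 2 * (2 * (2 * (2 * (2 * P)))) ≡ 32 * P
  times32 = solve-∀

oddPart-pos : ∀ sh → 0 < oddPart sh
oddPart-pos pow         = z<s
oddPart-pos pow⁺        = z<s
oddPart-pos (bin a)     = m≤n+m 1 (2 ^ suc a)
oddPart-pos (bin⁺ a)    = m≤n+m 1 (2 ^ suc a)
oddPart-pos (formA x y) = m≤n+m 1 (2 ^ suc x * 2 ^ suc y + 2 ^ suc x)
oddPart-pos (formB x y) = *-mono-≤ (m≤n+m 1 (2 ^ suc x * 2 ^ suc y)) (m≤n+m 1 (2 ^ suc x))
oddPart-pos (formC x)   = *-mono-≤ {1} {3} (s≤s z≤n) (m≤n+m 1 (3 * 2 ^ suc x))
oddPart-pos formD       = z<s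

Small : Shape → Set
Small sh = 2 * oddPart sh ≤ 2 ^ cost sh

Tight : Shape → Set
Tight sh = 2 * oddPart sh + 2 ≤ 2 ^ cost sh

-- 2^cost sh ≥ (1 + 2^-r) · 2 · oddPart sh: exactly what rules out the product with bin (r ∸ 1).
record Roomy (r : ℕ) (sh : Shape) : Set where
  constructor roomy
  field
    bound : 2 * oddPart sh * (2 ^ r + 1) ≤ 2 ^ r * 2 ^ cost sh

roomy-via-2^cost : ∀ {r sh P} → 2 ^ cost sh ≡ P → 2 * oddPart sh * (2 ^ r + 1) ≤ 2 ^ r * P → Roomy r sh
roomy-via-2^cost {r} eq bound = roomy (subst (λ Q → _ ≤ 2 ^ r * Q) (sym eq) bound)

roomy-suc : ∀ {r sh} → Roomy r sh → Roomy (suc r) sh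
roomy-suc {r} {sh} (roomy ρ) = roomy (begin
  A * (2 * R + 1)  ≤⟨ *-monoʳ-≤ A (+-monoʳ-≤ (2 * R) (s≤s z≤n)) ⟩
  A * (2 * R + 2)   ≡⟨ cong (A *_) (*-distribˡ-+ 2 R 1) ⟨
  A * (2 * (R + 1)) ≡⟨ x∙yz≈y∙xz A 2 (R + 1) ⟩
  2 * (A * (R + 1)) ≤⟨ *-monoʳ-≤ 2 ρ ⟩
  2 * (R * C)      ≡⟨ *-assoc 2 R C ⟨
  2 * R * C        ∎)
  where
  open ≤-Reasoning
  A = 2 * oddPart sh
  R = 2 ^ r
  C = 2 ^ cost sh

roomy-mono : ∀ {r r′ sh} → r ≤ r′ → Roomy r sh → Roomy r′ sh
roomy-mono {r} {r′} {sh} r≤r′ ρ = go (≤⇒≤′ r≤r′)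
  where
  go : ∀ {r′} → r ≤′ r′ → Roomy r′ sh
  go ≤′-refl       = ρ
  go (≤′-step r≤′) = roomy-suc (go r≤′)

-- Both sides are even, so a strict inequality leaves a gap of 2.
even-gap : ∀ {o} c → 0 < o → 2 * o < 2 ^ c → 2 * o + 2 ≤ 2 ^ c
even-gap zero    o>0 lt = contradiction (≤-trans (s≤s z≤n) (*-monoʳ-≤ 2 o>0)) (<⇒≱ lt)
even-gap {o} (suc c) _ lt =
  subst (_≤ 2 ^ suc c) (trans (*-suc 2 o) (+-comm 2 (2 * o)))
        (*-monoʳ-≤ 2 (*-cancelˡ-< 2 o (2 ^ c) lt))

roomy⇒tight : ∀ {r} sh → Roomy r sh → Tight sh
roomy⇒tight {r} sh (roomy ρ) = even-gap (cost sh) (oddPart-pos sh) (*-cancelˡ-< R A C (begin-strict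
  R * A        <⟨ m<m+n (R * A) (≤-trans (s≤s z≤n) (*-monoʳ-≤ 2 (oddPart-pos sh))) ⟩
  R * A + A    ≡⟨ identity R A ⟩
  A * (R + 1)  ≤⟨ ρ ⟩
  R * C        ∎))
  where
  open ≤-Reasoning
  A = 2 * oddPart sh
  R = 2 ^ r
  C = 2 ^ cost sh
  identity : ∀ R A → R * A + A ≡ A * (R + 1)
  identity = solve-∀

tight⇒small : ∀ sh → Tight sh → Small sh
tight⇒small sh = m+n≤o⇒m≤o (2 * oddPart sh)

roomy₁-bin⁺ : ∀ b → Roomy 1 (bin⁺ (suc b))
roomy₁-bin⁺ b = roomy $ positive-≤₁ (λ B → 2 * (2 * (2 * B) + 1) * 3) (λ B → 2 * (2 * (2 * (2 * (2 * B)))))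
                            (λ b → 2 + 8 * b) solve-∀ (2^>0 b)

roomy₁-formA : ∀ x y → Roomy 1 (formA x (2 + y))
roomy₁-formA x y = roomy-via-2^cost (2^cost-formA x (2 + y)) $
  positive-≤₂ (λ X Y → 2 * (2 * X * (2 * (2 * (2 * Y))) + 2 * X + 1) * 3)
              (λ X Y → 2 * (16 * (X * (2 * (2 * Y)))))
              (λ x y → 14 + 20 * x + 32 * y + 32 * x * y) solve-∀ (2^>0 x) (2^>0 y)

roomy₁-formA-1 : ∀ x → Roomy 1 (formA (suc x) 1)
roomy₁-formA-1 x = roomy-via-2^cost (2^cost-formA (suc x) 1) $
  positive-≤₁ (λ X → 2 * (2 * (2 * X) * 4 + 2 * (2 * X) + 1) * 3) (λ X → 2 * (16 * (2 * X * 2)))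
              (λ x → 2 + 8 * x) solve-∀ (2^>0 x)

roomy₂-formA-0 : ∀ x → Roomy 2 (formA (2 + x) 0)
roomy₂-formA-0 x = roomy-via-2^cost (2^cost-formA (2 + x) 0) $
  positive-≤₁ (λ X → 2 * (2 * (2 * (2 * X)) * 2 + 2 * (2 * (2 * X)) + 1) * 5)
              (λ X → 4 * (16 * (2 * (2 * X) * 1)))
              (λ x → 6 + 16 * x) solve-∀ (2^>0 x)

roomy₁-formB : ∀ x y → Roomy 1 (formB (2 + x) y)
roomy₁-formB x y = roomy-via-2^cost (2^cost-formB (2 + x) y) $
  positive-≤₂ (λ X Y → 2 * ((2 * (2 * (2 * X)) * (2 * Y) + 1) * (2 * (2 * (2 * X)) + 1)) * 3)
              (λ X Y → 2 * (32 * (2 * (2 * X) * (2 * (2 * X) * Y))))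
              (λ x y → 106 + 368 * x + 160 * y + 256 * x * x + 416 * x * y + 256 * x * x * y)
              solve-∀ (2^>0 x) (2^>0 y)

roomy₁-formB-1 : ∀ y → Roomy 1 (formB 1 (suc y))
roomy₁-formB-1 y = roomy-via-2^cost (2^cost-formB 1 (suc y)) $
  positive-≤₁ (λ Y → 2 * ((4 * (2 * (2 * Y)) + 1) * 5) * 3) (λ Y → 2 * (32 * (2 * (2 * (2 * Y)))))
              (λ y → 2 + 32 * y) solve-∀ (2^>0 y)

roomy₂-formB-0 : ∀ y → Roomy 2 (formB 0 (2 + y))
roomy₂-formB-0 y = roomy-via-2^cost (2^cost-formB 0 (2 + y)) $
  positive-≤₁ (λ Y → 2 * ((2 * (2 * (2 * (2 * Y))) + 1) * 3) * 5)
              (λ Y → 4 * (32 * (1 * (1 * (2 * (2 * Y))))))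
              (λ y → 2 + 32 * y) solve-∀ (2^>0 y)

roomy₁-formC : ∀ x → Roomy 1 (formC x)
roomy₁-formC x = roomy $ positive-≤₁ (λ X → 2 * (3 * (3 * (2 * X) + 1)) * 3)
                             (λ X → 2 * (2 * (2 * (2 * (2 * (2 * (2 * X)))))))
                             (λ x → 2 + 20 * x) solve-∀ (2^>0 x)

roomy-bin⁺ : ∀ b → Roomy 2 (bin⁺ b)
roomy-bin⁺ zero    = roomy (≤ᵇ⇒≤ _ _ _)
roomy-bin⁺ (suc b) = roomy-suc (roomy₁-bin⁺ b)

roomy-formA : ∀ x y → Roomy 3 (formA x y)
roomy-formA 0               0               = roomy (≤ᵇ⇒≤ _ _ _)
roomy-formA 1               0               = roomy (≤ᵇ⇒≤ _ _ _)
roomy-formA (suc (suc x))   0               = roomy-suc (roomy₂-formA-0 x)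
roomy-formA 0               1               = roomy (≤ᵇ⇒≤ _ _ _)
roomy-formA (suc x)         1               = roomy-mono (s≤s z≤n) (roomy₁-formA-1 x)
roomy-formA x               (suc (suc y))   = roomy-mono (s≤s z≤n) (roomy₁-formA x y)

roomy-formB : ∀ x y → Roomy 4 (formB x y)
roomy-formB 0             0             = roomy (≤ᵇ⇒≤ _ _ _)
roomy-formB 0             1             = roomy (≤ᵇ⇒≤ _ _ _)
roomy-formB 0             (suc (suc y)) = roomy-mono (s≤s (s≤s z≤n)) (roomy₂-formB-0 y)
roomy-formB 1             0             = roomy (≤ᵇ⇒≤ _ _ _)
roomy-formB 1             (suc y)       = roomy-mono (s≤s z≤n) (roomy₁-formB-1 y)
roomy-formB (suc (suc x)) y             = roomy-mono (s≤s z≤n) (roomy₁-formB x y)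

data ShapeView : Shape → Set where
  pow   : ShapeView pow
  pow⁺  : ShapeView pow⁺
  bin   : ∀ a → ShapeView (bin a)
  tight : ∀ {sh} → Tight sh → ShapeView sh

view : ∀ sh → ShapeView sh
view pow         = pow
view pow⁺        = pow⁺
view (bin a)     = bin a
view (bin⁺ b)    = tight (roomy⇒tight (bin⁺ b) (roomy-bin⁺ b))
view (formA x y) = tight (roomy⇒tight (formA x y) (roomy-formA x y))
view (formB x y) = tight (roomy⇒tight (formB x y) (roomy-formB x y))
view (formC x)   = tight (roomy⇒tight (formC x) (roomy₁-formC x))
view formD       = tight (≤ᵇ⇒≤ _ _ _)

-- Efficient expressions are shaped

record Product (sh₁ sh₂ : Shape) : Set where
  constructor product
  field
    shape     : Shape
    oddPart-≡ : oddPart shape ≡ oddPart sh₁ * oddPart sh₂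
    cost-≡    : cost shape ≡ cost sh₁ + cost sh₂
    minTwos-≤ : minTwos shape ≤ minTwos sh₁ + minTwos sh₂

EfficientProduct : Shape → Shape → Set
EfficientProduct sh₁ sh₂ = Efficient (cost sh₁ + cost sh₂) (oddPart sh₁ * oddPart sh₂)

product-swap : ∀ {sh₁ sh₂} → Product sh₂ sh₁ → Product sh₁ sh₂
product-swap {sh₁} {sh₂} (product sh o c t) =
  product sh (trans o (*-comm (oddPart sh₂) (oddPart sh₁))) (trans c (+-comm (cost sh₂) (cost sh₁)))
          (subst (minTwos sh ≤_) (+-comm (minTwos sh₂) (minTwos sh₁)) t)

efficientProduct-swap : ∀ sh₁ sh₂ → EfficientProduct sh₁ sh₂ → EfficientProduct sh₂ sh₁
efficientProduct-swap sh₁ sh₂ =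
  subst₂ Efficient (+-comm (cost sh₁) (cost sh₂)) (*-comm (oddPart sh₁) (oddPart sh₂))

pow-product : ∀ sh → Product pow sh
pow-product sh = product sh (sym (*-identityˡ _)) refl (n≤1+n _)

bin-pow⁺ : ∀ a → Product (bin a) pow⁺
bin-pow⁺ a = product (bin⁺ a) (sym (*-identityʳ _)) (+-comm 1 (2 + a)) (s≤s z≤n)

bin-square : ∀ a → Product (bin a) (bin a)
bin-square zero    = product (bin 2) refl refl (s≤s z≤n)
bin-square (suc a) = product (formA (2 + a) a) (odd (2 ^ a)) (copies-identity a) (s≤s z≤n)
  where
  odd : ∀ A → 2 * (2 * (2 * A)) * (2 * A) + 2 * (2 * (2 * A)) + 1 ≡ (2 * (2 * A) + 1) * (2 * (2 * A) + 1)
  odd = solve-∀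
  copies-identity : ∀ a → 4 + (2 + a + a) ≡ 3 + a + (3 + a)
  copies-identity = solve-∀

bin-bin-< : ∀ a k → Product (bin a) (bin (suc (a + k)))
bin-bin-< a k = product (formB a k) odd (copies-identity a k) (s≤s (s≤s z≤n))
  where
  odd-identity : ∀ A K → (2 * A * (2 * K) + 1) * (2 * A + 1) ≡ (2 * A + 1) * (2 * (2 * (A * K)) + 1)
  odd-identity = solve-∀
  odd : oddPart (formB a k) ≡ oddPart (bin a) * oddPart (bin (suc (a + k)))
  odd = trans (odd-identity (2 ^ a) (2 ^ k))
              (cong (λ P → (2 * 2 ^ a + 1) * (2 * (2 * P) + 1)) (sym (^-distribˡ-+-* 2 a k)))
  copies-identity : ∀ a k → 5 + (a + (a + k)) ≡ 2 + a + (2 + suc (a + k))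
  copies-identity = solve-∀

bin-bin : ∀ a b → Product (bin a) (bin b)
bin-bin a b with compare a b
... | less    a k = bin-bin-< a k
... | equal   a   = bin-square a
... | greater b k = product-swap (bin-bin-< b k)

-- Apart from the listed exceptions, bin a times sh is inefficient (bin-roomy-inefficient).
bin-product-or-roomy : ∀ a sh → Product (bin a) sh ⊎ Roomy (suc a) sh
bin-product-or-roomy a pow     = inj₁ (product-swap (pow-product (bin a)))
bin-product-or-roomy a pow⁺    = inj₁ (bin-pow⁺ a)
bin-product-or-roomy a (bin b) = inj₁ (bin-bin a b)
bin-product-or-roomy 0 (bin⁺ 0)       = inj₁ (product (bin⁺ 2) refl refl (≤ᵇ⇒≤ _ _ _))
bin-product-or-roomy 0 (bin⁺ (suc b)) = inj₂ (roomy₁-bin⁺ b)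
bin-product-or-roomy (suc a) (bin⁺ b) = inj₂ (roomy-mono (s≤s (s≤s z≤n)) (roomy-bin⁺ b))
bin-product-or-roomy 0 (formA x 0)             = inj₁ (product (formC x) (odd (2 ^ x)) (copies-identity x) ≤-refl)
  where
  odd : ∀ X → 3 * (3 * (2 * X) + 1) ≡ 3 * (2 * X * 2 + 2 * X + 1)
  odd = solve-∀
  copies-identity : ∀ x → 6 + x ≡ 2 + (4 + (x + 0))
  copies-identity = solve-∀
bin-product-or-roomy 0 (formA 0 1)             = inj₁ (product (bin⁺ 4) refl refl (≤ᵇ⇒≤ _ _ _))
bin-product-or-roomy 0 (formA (suc x) 1)       = inj₂ (roomy₁-formA-1 x)
bin-product-or-roomy 0 (formA x (suc (suc y))) = inj₂ (roomy₁-formA x y)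
bin-product-or-roomy 1 (formA 0 0)             = inj₁ (product (formA 0 3) refl refl (≤ᵇ⇒≤ _ _ _))
bin-product-or-roomy 1 (formA 1 0)             = inj₁ (product (bin⁺ 5) refl refl (≤ᵇ⇒≤ _ _ _))
bin-product-or-roomy 1 (formA (suc (suc x)) 0) = inj₂ (roomy₂-formA-0 x)
bin-product-or-roomy 1 (formA 0 1)             = inj₂ (roomy (≤ᵇ⇒≤ _ _ _))
bin-product-or-roomy 1 (formA (suc x) 1)       = inj₂ (roomy-suc (roomy₁-formA-1 x))
bin-product-or-roomy 1 (formA x (suc (suc y))) = inj₂ (roomy-suc (roomy₁-formA x y))
bin-product-or-roomy (suc (suc a)) (formA x y) = inj₂ (roomy-mono (s≤s (s≤s (s≤s z≤n))) (roomy-formA x y))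
bin-product-or-roomy 0 (formB 0 0)             = inj₁ (product (formB 1 0) refl refl (≤ᵇ⇒≤ _ _ _))
bin-product-or-roomy 0 (formB 0 1)             = inj₁ (product (formA 3 1) refl refl (≤ᵇ⇒≤ _ _ _))
bin-product-or-roomy 0 (formB 0 (suc (suc y))) = inj₁ (product (formB 2 y) (odd (2 ^ y)) refl (n≤1+n 2))
  where
  odd : ∀ Y → (8 * (2 * Y) + 1) * 9 ≡ 3 * ((2 * (2 * (2 * (2 * Y))) + 1) * 3)
  odd = solve-∀
bin-product-or-roomy 0 (formB 1 0)             = inj₁ (product formD refl refl ≤-refl)
bin-product-or-roomy 0 (formB 1 (suc y))       = inj₂ (roomy₁-formB-1 y)
bin-product-or-roomy 0 (formB (suc (suc x)) y) = inj₂ (roomy₁-formB x y)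
bin-product-or-roomy 1 (formB 0 0)             = inj₁ (product (formC 2) refl refl (≤ᵇ⇒≤ _ _ _))
bin-product-or-roomy 1 (formB 0 1)             = inj₁ (product formD refl refl ≤-refl)
bin-product-or-roomy 1 (formB 0 (suc (suc y))) = inj₂ (roomy₂-formB-0 y)
bin-product-or-roomy 1 (formB 1 0)             = inj₂ (roomy (≤ᵇ⇒≤ _ _ _))
bin-product-or-roomy 1 (formB 1 (suc y))       = inj₂ (roomy-suc (roomy₁-formB-1 y))
bin-product-or-roomy 1 (formB (suc (suc x)) y) = inj₂ (roomy-suc (roomy₁-formB x y))
bin-product-or-roomy 2 (formB 0 0)             = inj₁ (product formD refl refl ≤-refl)
bin-product-or-roomy 2 (formB 0 1)             = inj₂ (roomy (≤ᵇ⇒≤ _ _ _))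
bin-product-or-roomy 2 (formB 0 (suc (suc y))) = inj₂ (roomy-suc (roomy₂-formB-0 y))
bin-product-or-roomy 2 (formB 1 0)             = inj₂ (roomy (≤ᵇ⇒≤ _ _ _))
bin-product-or-roomy 2 (formB 1 (suc y))       = inj₂ (roomy-mono (s≤s z≤n) (roomy₁-formB-1 y))
bin-product-or-roomy 2 (formB (suc (suc x)) y) = inj₂ (roomy-mono (s≤s z≤n) (roomy₁-formB x y))
bin-product-or-roomy (suc (suc (suc a))) (formB x y) =
  inj₂ (roomy-mono (s≤s (s≤s (s≤s (s≤s z≤n)))) (roomy-formB x y))
bin-product-or-roomy a (formC x) = inj₂ (roomy-mono (s≤s z≤n) (roomy₁-formC x))
bin-product-or-roomy a formD     = inj₂ (roomy-mono (s≤s z≤n) (roomy (≤ᵇ⇒≤ _ _ _)))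

bin-roomy-inefficient : ∀ {a sh} → Roomy (suc a) sh → ¬ EfficientProduct (bin a) sh
bin-roomy-inefficient {a} {sh} (roomy ρ) eff = <⇒≱ eff (begin
  4 * ((R + 1) * o)          ≡⟨ identity R o ⟩
  2 * (2 * o * (R + 1))      ≤⟨ *-monoʳ-≤ 2 ρ ⟩
  2 * (R * 2 ^ cost sh)      ≡⟨ cong (2 *_) (^-distribˡ-+-* 2 (suc a) (cost sh)) ⟨
  2 * 2 ^ (suc a + cost sh)  ∎)
  where
  open ≤-Reasoning
  R = 2 ^ suc a
  o = oddPart sh
  identity : ∀ R o → 4 * ((R + 1) * o) ≡ 2 * (2 * o * (R + 1))
  identity = solve-∀

small-small-inefficient : ∀ sh₁ sh₂ → Small sh₁ → Small sh₂ → ¬ EfficientProduct sh₁ sh₂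
small-small-inefficient sh₁ sh₂ small₁ small₂ eff = <⇒≱ eff (begin
  4 * (oddPart sh₁ * oddPart sh₂)          ≡⟨ [m*n]*[o*p]≡[m*o]*[n*p] 2 2 (oddPart sh₁) (oddPart sh₂) ⟩
  2 * oddPart sh₁ * (2 * oddPart sh₂)      ≤⟨ *-mono-≤ small₁ small₂ ⟩
  2 ^ cost sh₁ * 2 ^ cost sh₂              ≡⟨ ^-distribˡ-+-* 2 (cost sh₁) (cost sh₂) ⟨
  2 ^ (cost sh₁ + cost sh₂)                ∎)
  where open ≤-Reasoning

bin-product : ∀ a sh → EfficientProduct (bin a) sh → Product (bin a) sh
bin-product a sh eff = [ id , (λ ρ → contradiction eff (bin-roomy-inefficient ρ)) ]′ (bin-product-or-roomy a sh)

shape-product : ∀ sh₁ sh₂ → EfficientProduct sh₁ sh₂ → Product sh₁ sh₂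
shape-product sh₁ sh₂ eff with view sh₁ | view sh₂
... | pow      | _        = pow-product sh₂
... | bin a    | _        = bin-product a sh₂ eff
... | _        | pow      = product-swap (pow-product sh₁)
... | _        | bin b    = product-swap (bin-product b sh₁ (efficientProduct-swap sh₁ (bin b) eff))
... | pow⁺     | pow⁺     = contradiction eff (small-small-inefficient pow⁺ pow⁺ ≤-refl ≤-refl)
... | pow⁺     | tight t  = contradiction eff (small-small-inefficient pow⁺ sh₂ ≤-refl (tight⇒small sh₂ t))
... | tight t  | pow⁺     = contradiction eff (small-small-inefficient sh₁ pow⁺ (tight⇒small sh₁ t) ≤-refl)
... | tight t  | tight t′ = contradiction eff (small-small-inefficient sh₁ sh₂ (tight⇒small sh₁ t) (tight⇒small sh₂ t′))

shaped-* : ∀ {k₁ v₁ k₂ v₂} → Shaped k₁ v₁ → Shaped k₂ v₂ →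
           Efficient (k₁ + k₂) (v₁ * v₂) → Shaped (k₁ + k₂) (v₁ * v₂)
shaped-* (shaped s₁ sh₁ twos₁ refl refl) (shaped s₂ sh₂ twos₂ refl refl) eff =
  shaped (s₁ + suc s₂) (Product.shape P) (≤-trans (Product.minTwos-≤ P) (+-mono-≤ twos₁ twos₂))
         (trans values (cong (2 ^ t *_) (sym (Product.oddPart-≡ P))))
         (trans costs (cong (t +_) (sym (Product.cost-≡ P))))
  where
  t = suc s₁ + suc s₂
  values : 2 ^ suc s₁ * oddPart sh₁ * (2 ^ suc s₂ * oddPart sh₂) ≡ 2 ^ t * (oddPart sh₁ * oddPart sh₂)
  values = trans ([m*n]*[o*p]≡[m*o]*[n*p] (2 ^ suc s₁) (oddPart sh₁) (2 ^ suc s₂) (oddPart sh₂))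
                 (cong (_* (oddPart sh₁ * oddPart sh₂)) (sym (^-distribˡ-+-* 2 (suc s₁) (suc s₂))))
  costs : suc s₁ + cost sh₁ + (suc s₂ + cost sh₂) ≡ t + (cost sh₁ + cost sh₂)
  costs = +-interchange (suc s₁) (cost sh₁) (suc s₂) (cost sh₂)
  P : Product sh₁ sh₂
  P = shape-product sh₁ sh₂ (efficient-scale t (subst₂ Efficient costs values eff))

tight-gap : ∀ s sh → Tight sh → 2 * (2 + 2 ^ suc s * oddPart sh) ≤ 2 ^ (suc s + cost sh)
tight-gap s sh t = begin
  2 * (2 + 2 ^ suc s * oddPart sh)   ≤⟨ positive-≤₂ (λ S O → 2 * (2 + 2 * S * O)) (λ S O → 2 * S * (2 * O + 2))
                                                     (λ s o → 4 * s) solve-∀ (2^>0 s) (oddPart-pos sh) ⟩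
  2 ^ suc s * (2 * oddPart sh + 2)   ≤⟨ *-monoʳ-≤ (2 ^ suc s) t ⟩
  2 ^ suc s * 2 ^ cost sh            ≡⟨ ^-distribˡ-+-* 2 (suc s) (cost sh) ⟨
  2 ^ (suc s + cost sh)              ∎
  where open ≤-Reasoning

shaped-2+ : ∀ {k v} → Shaped k v → Efficient (1 + k) (2 + v) → Shaped (1 + k) (2 + v)
shaped-2+ (shaped s sh _ refl refl) = go s (view sh)
  where
  doubled : ∀ S → 2 + 2 * (2 * S) * 1 ≡ 2 * (2 * S + 1)
  doubled = solve-∀
  go : ∀ s {sh} → ShapeView sh →
       Efficient (1 + (suc s + cost sh)) (2 + 2 ^ suc s * oddPart sh) →
       Shaped (1 + (suc s + cost sh)) (2 + 2 ^ suc s * oddPart sh)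
  go zero    pow           _   = shaped 1 pow (s≤s z≤n) refl refl
  go (suc s) pow           _   = shaped 0 (bin s) ≤-refl (doubled (2 ^ s)) (cong (3 +_) (+-identityʳ s))
  go zero    pow⁺          _   = shaped 1 pow⁺ (s≤s z≤n) refl refl
  go (suc s) pow⁺          _   = shaped 0 (bin⁺ s) ≤-refl (doubled (2 ^ s)) (cong (3 +_) (+-comm s 1))
  go zero    (bin zero)    _   = shaped 2 pow⁺ (s≤s z≤n) refl refl
  go zero    (bin (suc a)) _   = shaped 1 (bin⁺ a) (s≤s z≤n) (value (2 ^ a)) refl
    where
    value : ∀ A → 2 + 2 * (2 * (2 * A) + 1) ≡ 4 * (2 * A + 1)
    value = solve-∀
  go (suc s) (bin a)       _   = shaped 0 (formA s a) ≤-refl (value (2 ^ s) (2 ^ a)) (copies-identity s a)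
    where
    value : ∀ S A → 2 + 2 * (2 * S) * (2 * A + 1) ≡ 2 * (2 * S * (2 * A) + 2 * S + 1)
    value = solve-∀
    copies-identity : ∀ s a → 1 + (2 + s + (2 + a)) ≡ 1 + (4 + (s + a))
    copies-identity = solve-∀
  go s       (tight {sh} t) eff =
    contradiction eff (¬efficient-2+ (suc s + cost sh) (2 ^ suc s * oddPart sh) (tight-gap s sh t))

shaped-4+ : ∀ {k v} → Shaped k v → Efficient (2 + k) (4 + v) → Shaped (2 + k) (4 + v)
shaped-4+ (shaped s sh _ refl refl) = go s (view sh)
  where
  ¬efficient : ∀ s sh → 4 + 2 ^ suc s * oddPart sh ≤ 2 ^ suc s * 2 ^ cost sh →
               ¬ Efficient (2 + (suc s + cost sh)) (4 + 2 ^ suc s * oddPart sh)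
  ¬efficient s sh bound = ¬efficient-4+ (suc s + cost sh) (2 ^ suc s * oddPart sh)
    (subst (4 + 2 ^ suc s * oddPart sh ≤_) (sym (^-distribˡ-+-* 2 (suc s) (cost sh))) bound)
  go : ∀ s {sh} → ShapeView sh →
       Efficient (2 + (suc s + cost sh)) (4 + 2 ^ suc s * oddPart sh) →
       Shaped (2 + (suc s + cost sh)) (4 + 2 ^ suc s * oddPart sh)
  go 0             pow           _   = shaped 0 (bin 0) ≤-refl refl refl
  go 1             pow           _   = shaped 2 pow⁺ (s≤s z≤n) refl refl
  go (suc (suc s)) pow           _   = shaped 1 (bin⁺ s) (s≤s z≤n) (value (2 ^ s)) (cong (5 +_) (+-identityʳ s))
    where
    value : ∀ S → 4 + 2 * (2 * (2 * S)) * 1 ≡ 4 * (2 * S + 1)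
    value = solve-∀
  go 0             pow⁺          _   = shaped 0 (bin⁺ 0) ≤-refl refl refl
  go (suc s)       pow⁺          eff = contradiction eff (¬efficient (suc s) pow⁺
    (positive-≤₁ (λ S → 4 + 2 * (2 * S) * 1) (λ S → 2 * (2 * S) * 2) (λ s → 4 * s) solve-∀ (2^>0 s)))
  go 0             (bin 0)       _   = shaped 0 (bin⁺ 1) ≤-refl refl refl
  go 0             (bin (suc a)) eff = contradiction eff (¬efficient 0 (bin (suc a))
    (positive-≤₁ (λ A → 4 + 2 * (2 * (2 * A) + 1)) (λ A → 2 * (2 * (2 * (2 * A))))
                 (λ a → 2 + 8 * a) solve-∀ (2^>0 a)))
  go (suc s)       (bin a)       eff = contradiction eff (¬efficient (suc s) (bin a)
    (positive-≤₂ (λ S A → 4 + 2 * (2 * S) * (2 * A + 1)) (λ S A → 2 * (2 * S) * (2 * (2 * A)))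
                 (λ s a → 8 * a + 4 * s + 8 * a * s) solve-∀ (2^>0 s) (2^>0 a)))
  go s             (tight {sh} t) eff = contradiction eff (¬efficient-4+ (suc s + cost sh) (2 ^ suc s * oddPart sh)
    (≤-trans (4+n≤2*[2+n] (2 ^ suc s * oddPart sh)) (tight-gap s sh t)))

add-two : ∀ {l w} → 2 ≤ w → (Efficient l w → Shaped l w) →
          Efficient (1 + l) (2 + w) → Shaped (1 + l) (2 + w)
add-two {l} {w} w≥2 shaped-w eff = shaped-2+ (shaped-w (efficient-+ {1} {l} {w} (s≤s z≤n) w≥2 eff)) eff

add-four : ∀ {l w} → 2 ≤ w → (Efficient l w → Shaped l w) →
           Efficient (2 + l) (4 + w) → Shaped (2 + l) (4 + w)
add-four {l} {w} w≥2 shaped-w eff = shaped-4+ (shaped-w (efficient-+ {2} {l} {w} (s≤s z≤n) w≥2 eff)) eff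

shaped-commute : ∀ {k l v w} → (Efficient (l + k) (w + v) → Shaped (l + k) (w + v)) →
                 Efficient (k + l) (v + w) → Shaped (k + l) (v + w)
shaped-commute {k} {l} {v} {w} shaped-sum eff =
  subst₂ Shaped (+-comm l k) (+-comm w v) (shaped-sum (subst₂ Efficient (+-comm k l) (+-comm v w) eff))

-- In an efficient sum one summand is 2 or 4: two large summands waste a copy.
shaped-+ : ∀ {k l v w} → Size k v → Size l w → 2 ≤ v → 2 ≤ w → v ≤ 2 ^ k → w ≤ 2 ^ l →
           (Efficient k v → Shaped k v) → (Efficient l w → Shaped l w) →
           Efficient (k + l) (v + w) → Shaped (k + l) (v + w)
shaped-+ (single refl refl) _ _ w≥2 _ _ _ shaped-w = add-two w≥2 shaped-w
shaped-+ (double refl refl) _ _ w≥2 _ _ _ shaped-w = add-four w≥2 shaped-w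
shaped-+ {k} {v = v} (large _) (single refl refl) v≥2 _ _ _ shaped-v _ =
  shaped-commute {k} {1} {v} {2} (add-two v≥2 shaped-v)
shaped-+ {k} {v = v} (large _) (double refl refl) v≥2 _ _ _ shaped-v _ =
  shaped-commute {k} {2} {v} {4} (add-four v≥2 shaped-v)
shaped-+ (large 3≤k) (large 3≤l) _ _ v≤2^k w≤2^l _ _ eff =
  contradiction eff (¬efficient-+ 3≤k 3≤l v≤2^k w≤2^l)

shaped-of-efficient : ∀ e → Efficient (copies e) (eval e) → Shaped (copies e) (eval e)
shaped-of-efficient two     _   = shaped 0 pow ≤-refl refl refl
shaped-of-efficient (e ⊕ f)     =
  shaped-+ (size e) (size f) (eval≥2 e) (eval≥2 f) (eval≤2^copies e) (eval≤2^copies f)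
           (shaped-of-efficient e) (shaped-of-efficient f)
shaped-of-efficient (e ⊗ f) eff = shaped-*
  (shaped-of-efficient e (efficient-*ˡ {copies e} {copies f} {eval e} {eval f} (eval≤2^copies f) eff))
  (shaped-of-efficient f (efficient-*ʳ {copies e} {copies f} {eval e} {eval f} (eval≤2^copies e) eff))
  eff

-- The forms of the theorem

Form₁ : ℕ → ℕ → Set
Form₁ m n = n ≡ 2 ^ (m + 1) ⊎ Σ ℕ (λ m′ → 1 ≤ m′ × m′ < m × n ≡ 2 ^ m + 2 ^ m′)

FormA FormB FormC FormD Form₂ : ℕ → ℕ → Set
FormA m n = Σ ℕ (λ m₂ → Σ ℕ (λ m₃ → m₂ < m × m₃ < m₂ × 1 ≤ m₃ × n ≡ 2 ^ m + 2 ^ m₂ + 2 ^ m₃))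
FormB m n = Σ ℕ (λ m₂ → Σ ℕ (λ m₃ → Σ ℕ (λ m₄ →
  m₂ < m × m₃ < m₂ × m₄ < m₃ × 2 ≤ m₄ × m + m₄ ≡ m₂ + m₃ × n ≡ 2 ^ m + 2 ^ m₂ + 2 ^ m₃ + 2 ^ m₄)))
FormC m n = Σ ℕ (λ m₂ → m₂ + 3 ≤ m × 6 ≤ m₂ + 3 × n ≡ 2 ^ m + 2 ^ (m ∸ 3) + 2 ^ m₂ + 2 ^ (m₂ ∸ 1))
FormD m n = 10 ≤ m × n ≡ 2 ^ m + 2 ^ (m ∸ 5) + 2 ^ (m ∸ 6) + 2 ^ (m ∸ 7)
Form₂ m n = FormA m n ⊎ FormB m n ⊎ FormC m n ⊎ FormD m n

bin-value : ∀ s a → 2 ^ suc s * oddPart (bin a) ≡ 2 ^ (suc s + suc a) + 2 ^ suc s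
bin-value s a = trans (identity (2 ^ suc s) (2 ^ suc a))
                      (cong (_+ 2 ^ suc s) (sym (^-distribˡ-+-* 2 (suc s) (suc a))))
  where
  identity : ∀ S A → S * (A + 1) ≡ S * A + S
  identity = solve-∀

formA-value : ∀ s x y → 2 ^ suc s * oddPart (formA x y) ≡
              2 ^ (suc s + suc x + suc y) + 2 ^ (suc s + suc x) + 2 ^ suc s
formA-value s x y = trans (identity (2 ^ suc s) (2 ^ suc x) (2 ^ suc y))
  (sym (cong₂ (λ u w → u + w + 2 ^ suc s) (2^-+₃ (suc s) (suc x) (suc y)) (^-distribˡ-+-* 2 (suc s) (suc x))))
  where
  identity : ∀ S X Y → S * (X * Y + X + 1) ≡ S * X * Y + S * X + S
  identity = solve-∀

formB-value : ∀ s x y → 2 ^ s * oddPart (formB x y) ≡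
              2 ^ (s + suc x + suc y + suc x) + 2 ^ (s + suc x + suc y) + 2 ^ (s + suc x) + 2 ^ s
formB-value s x y = trans (identity (2 ^ s) (2 ^ suc x) (2 ^ suc y))
  (sym (cong₂ (λ u w → u + w + 2 ^ s)
              (cong₂ _+_ (2^-+₄ s (suc x) (suc y) (suc x)) (2^-+₃ s (suc x) (suc y)))
              (^-distribˡ-+-* 2 s (suc x))))
  where
  identity : ∀ S X Y → S * ((X * Y + 1) * (X + 1)) ≡ S * X * Y * X + S * X * Y + S * X + S
  identity = solve-∀

formC-value : ∀ s x → 2 ^ (2 + s) * oddPart (formC x) ≡
              2 ^ (6 + s + x) + 2 ^ (3 + s + x) + 2 ^ (3 + s) + 2 ^ (2 + s)
formC-value s x = trans (identity (2 ^ s) (2 ^ x))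
  (sym (cong₂ _+_ (cong₂ _+_ (cong₂ _+_ (2^-+₃ 6 s x) (2^-+₃ 3 s x)) (^-distribˡ-+-* 2 3 s))
                  (^-distribˡ-+-* 2 2 s)))
  where
  identity : ∀ S X → 2 * (2 * S) * (3 * (3 * (2 * X) + 1)) ≡ 64 * S * X + 8 * S * X + 8 * S + 4 * S
  identity = solve-∀

formD-value : ∀ s → 2 ^ (3 + s) * oddPart formD ≡ 2 ^ (10 + s) + 2 ^ (5 + s) + 2 ^ (4 + s) + 2 ^ (3 + s)
formD-value s = trans (identity (2 ^ s))
  (sym (cong₂ _+_ (cong₂ _+_ (cong₂ _+_ (^-distribˡ-+-* 2 10 s) (^-distribˡ-+-* 2 5 s))
                             (^-distribˡ-+-* 2 4 s))
                  (^-distribˡ-+-* 2 3 s)))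
  where
  identity : ∀ S → 2 * (2 * (2 * S)) * 135 ≡ 1024 * S + 32 * S + 16 * S + 8 * S
  identity = solve-∀

shaped-small-≤ : ∀ {m} s sh → Small sh → m + 1 ≡ suc s + cost sh → 2 ^ suc s * oddPart sh ≤ 2 ^ m
shaped-small-≤ {m} s sh small copies = *-cancelˡ-≤ 2 (begin
  2 * (2 ^ suc s * oddPart sh)  ≡⟨ x∙yz≈y∙xz 2 (2 ^ suc s) (oddPart sh) ⟩
  2 ^ suc s * (2 * oddPart sh)  ≤⟨ *-monoʳ-≤ (2 ^ suc s) small ⟩
  2 ^ suc s * 2 ^ cost sh       ≡⟨ ^-distribˡ-+-* 2 (suc s) (cost sh) ⟨
  2 ^ (suc s + cost sh)         ≡⟨ cong (2 ^_) (trans (sym copies) (+-comm m 1)) ⟩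
  2 * 2 ^ m                     ∎)
  where open ≤-Reasoning

shaped-big-> : ∀ {m} s sh → 2 ^ cost sh < 2 * oddPart sh → m + 2 ≡ suc s + cost sh →
               2 ^ (m + 1) < 2 ^ suc s * oddPart sh
shaped-big-> {m} s sh big copies = *-cancelˡ-< 2 _ _ (begin-strict
  2 * 2 ^ (m + 1)               ≡⟨ cong (2 ^_) (trans (sym (+-suc m 1)) copies) ⟩
  2 ^ (suc s + cost sh)         ≡⟨ ^-distribˡ-+-* 2 (suc s) (cost sh) ⟩
  2 ^ suc s * 2 ^ cost sh       <⟨ *-monoʳ-< (2 ^ suc s) {{m^n≢0 2 (suc s)}} big ⟩
  2 ^ suc s * (2 * oddPart sh)  ≡⟨ x∙yz≈y∙xz 2 (2 ^ suc s) (oddPart sh) ⟨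
  2 * (2 ^ suc s * oddPart sh)  ∎)
  where open ≤-Reasoning

exponent-subst : ∀ (P : ℕ → Set) j {m E F} → m + j ≡ F → F ≡ E + j → P E → P m
exponent-subst P j {m} {E} m+j≡F F≡E+j = subst P (sym (+-cancelʳ-≡ j m E (trans m+j≡F F≡E+j)))

form₁-of-shaped : ∀ {m n} → 2 ^ m < n → Shaped (m + 1) n → Form₁ m n
form₁-of-shaped lo (shaped s sh _ refl copies) with view sh
... | pow     = exponent-subst (λ m → Form₁ m _) 1 copies (identity s)
                  (inj₁ (trans (*-identityʳ (2 ^ suc s)) (cong (2 ^_) (+-comm 1 s))))
  where
  identity : ∀ s → suc s + 0 ≡ s + 1
  identity = solve-∀
... | bin a   = exponent-subst (λ m → Form₁ m _) 1 copies (identity s a)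
                  (inj₂ (suc s , s≤s z≤n , m<m+n (suc s) z<s , bin-value s a))
  where
  identity : ∀ s a → suc s + (2 + a) ≡ suc s + suc a + 1
  identity = solve-∀
... | pow⁺    = contradiction lo (≤⇒≯ (shaped-small-≤ s pow⁺ ≤-refl copies))
... | tight t = contradiction lo (≤⇒≯ (shaped-small-≤ s sh (tight⇒small sh t) copies))

form₂-of-shaped : ∀ {m n} → n ≤ 2 ^ (m + 1) → ¬ Form₁ m n → Shaped (m + 2) n → Form₂ m n
form₂-of-shaped hi _ (shaped s pow _ refl copies) = contradiction hi (<⇒≱ (shaped-big-> s pow ≤-refl copies))
form₂-of-shaped hi _ (shaped s (bin a) _ refl copies) =
  contradiction hi (<⇒≱ (shaped-big-> s (bin a) (*-monoʳ-< 2 (m<m+n (2 * 2 ^ a) z<s)) copies))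
form₂-of-shaped _ ¬form₁ (shaped s pow⁺ _ refl copies) = contradiction
  (exponent-subst (λ m → Form₁ m _) 2 copies (identity s)
                  (inj₁ (trans (*-identityʳ (2 ^ suc s)) (cong (2 ^_) (+-comm 1 s)))))
  ¬form₁
  where
  identity : ∀ s → suc s + 1 ≡ s + 2
  identity = solve-∀
form₂-of-shaped _ ¬form₁ (shaped s (bin⁺ a) _ refl copies) = contradiction
  (exponent-subst (λ m → Form₁ m _) 2 copies (identity s a)
                  (inj₂ (suc s , s≤s z≤n , m<m+n (suc s) z<s , bin-value s a)))
  ¬form₁
  where
  identity : ∀ s a → suc s + (3 + a) ≡ suc s + suc a + 2
  identity = solve-∀
form₂-of-shaped _ _ (shaped s (formA x y) _ refl copies) =
  exponent-subst (λ m → Form₂ m _) 2 copies (identity s x y)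
    (inj₁ (suc s + suc x , suc s , m<m+n _ z<s , m<m+n _ z<s , s≤s z≤n , formA-value s x y))
  where
  identity : ∀ s x y → suc s + (4 + (x + y)) ≡ suc s + suc x + suc y + 2
  identity = solve-∀
form₂-of-shaped _ _ (shaped zero    (formB x y) (s≤s ()) _ _)
form₂-of-shaped _ _ (shaped (suc s) (formB x y) _ refl copies) =
  exponent-subst (λ m → Form₂ m _) 2 copies (identity s x y)
    (inj₂ (inj₁ (m₂ , m₃ , 2 + s , m<m+n m₂ z<s , m<m+n m₃ z<s , m<m+n (2 + s) z<s , s≤s (s≤s z≤n) ,
                 balance s x y , formB-value (2 + s) x y)))
  where
  m₃ = 2 + s + suc x
  m₂ = m₃ + suc y
  identity : ∀ s x y → 2 + s + (5 + (x + (x + y))) ≡ 2 + s + suc x + suc y + suc x + 2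
  identity = solve-∀
  balance : ∀ s x y → 2 + s + suc x + suc y + suc x + (2 + s) ≡ 2 + s + suc x + suc y + (2 + s + suc x)
  balance = solve-∀
form₂-of-shaped _ _ (shaped zero    (formC x) (s≤s ()) _ _)
form₂-of-shaped _ _ (shaped (suc s) (formC x) _ refl copies) =
  exponent-subst (λ m → Form₂ m _) 2 copies (identity s x)
    (inj₂ (inj₂ (inj₁ (3 + s , subst (_≤ 6 + s + x) (+-comm 3 (3 + s)) (m≤m+n (6 + s) x) ,
                       subst (6 ≤_) (+-comm 3 (3 + s)) (m≤m+n 6 s) , formC-value s x))))
  where
  identity : ∀ s x → 2 + s + (6 + x) ≡ 6 + s + x + 2
  identity = solve-∀
form₂-of-shaped _ _ (shaped zero          formD (s≤s ()) _ _)
form₂-of-shaped _ _ (shaped (suc zero)    formD (s≤s (s≤s ())) _ _)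
form₂-of-shaped _ _ (shaped (suc (suc s)) formD _ refl copies) =
  exponent-subst (λ m → Form₂ m _) 2 copies (identity s) (inj₂ (inj₂ (inj₂ (m≤m+n 10 s , formD-value s))))
  where
  identity : ∀ s → 3 + s + 9 ≡ 10 + s + 2
  identity = solve-∀

Representation : ℕ → ℕ → Set
Representation n k = Σ Expr (λ e → eval e ≡ n × copies e ≡ k)

rep-two : Representation 2 1
rep-two = two , refl , refl

_⊕ʳ_ : ∀ {a k b l} → Representation a k → Representation b l → Representation (a + b) (k + l)
(e , refl , refl) ⊕ʳ (f , refl , refl) = e ⊕ f , refl , refl

_⊗ʳ_ : ∀ {a k b l} → Representation a k → Representation b l → Representation (a * b) (k + l)
(e , refl , refl) ⊗ʳ (f , refl , refl) = e ⊗ f , refl , refl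

rep-pow : ∀ n → Representation (2 ^ suc n) (suc n)
rep-pow zero    = rep-two
rep-pow (suc n) = rep-two ⊗ʳ rep-pow n

rep-scale : ∀ n {v k} → Representation v k → Representation (2 ^ n * v) (n + k)
rep-scale zero    (e , refl , refl) = e , sym (*-identityˡ (eval e)) , refl
rep-scale (suc n) r                 = rep-pow n ⊗ʳ r

rep-six : Representation 6 3
rep-six = (rep-two ⊕ʳ rep-two) ⊕ʳ rep-two

rep-cast : ∀ {a k a′ k′} → Representation a k → a ≡ a′ → k ≡ k′ → Representation a′ k′
rep-cast r refl refl = r

realise-bin : ∀ s a → Representation (2 ^ suc s * oddPart (bin a)) (suc s + cost (bin a))
realise-bin s a = rep-cast (rep-scale s (rep-pow (suc a) ⊕ʳ rep-two)) (value (2 ^ s) (2 ^ a)) (copies-identity s a)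
  where
  value : ∀ S A → S * (2 * (2 * A) + 2) ≡ 2 * S * (2 * A + 1)
  value = solve-∀
  copies-identity : ∀ s a → s + (2 + a + 1) ≡ suc s + (2 + a)
  copies-identity = solve-∀

realise-formA : ∀ s x y → Representation (2 ^ suc s * oddPart (formA x y)) (suc s + cost (formA x y))
realise-formA s x y = rep-cast (rep-scale s ((rep-pow x ⊗ʳ (rep-pow (suc y) ⊕ʳ rep-two)) ⊕ʳ rep-two))
                               (value (2 ^ s) (2 ^ x) (2 ^ y)) (copies-identity s x y)
  where
  value : ∀ S X Y → S * (2 * X * (2 * (2 * Y) + 2) + 2) ≡ 2 * S * (2 * X * (2 * Y) + 2 * X + 1)
  value = solve-∀
  copies-identity : ∀ s x y → s + (suc x + (2 + y + 1) + 1) ≡ suc s + (4 + (x + y))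
  copies-identity = solve-∀

realise-formB : ∀ s x y → Representation (2 ^ (2 + s) * oddPart (formB x y)) (2 + s + cost (formB x y))
realise-formB s x y =
  rep-cast (rep-scale s (((rep-pow x ⊗ʳ rep-pow (suc y)) ⊕ʳ rep-two) ⊗ʳ (rep-pow (suc x) ⊕ʳ rep-two)))
           (value (2 ^ s) (2 ^ x) (2 ^ y)) (copies-identity s x y)
  where
  value : ∀ S X Y → S * ((2 * X * (2 * (2 * Y)) + 2) * (2 * (2 * X) + 2)) ≡
                    2 * (2 * S) * ((2 * X * (2 * Y) + 1) * (2 * X + 1))
  value = solve-∀
  copies-identity : ∀ s x y → s + (suc x + (2 + y) + 1 + (2 + x + 1)) ≡ 2 + s + (5 + (x + (x + y)))
  copies-identity = solve-∀

realise-formC : ∀ s x → Representation (2 ^ (2 + s) * oddPart (formC x)) (2 + s + cost (formC x))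
realise-formC s x = rep-cast (rep-scale s (rep-six ⊗ʳ ((rep-pow x ⊗ʳ rep-six) ⊕ʳ rep-two)))
                             (value (2 ^ s) (2 ^ x)) (copies-identity s x)
  where
  value : ∀ S X → S * (6 * (2 * X * 6 + 2)) ≡ 2 * (2 * S) * (3 * (3 * (2 * X) + 1))
  value = solve-∀
  copies-identity : ∀ s x → s + (3 + (suc x + 3 + 1)) ≡ 2 + s + (6 + x)
  copies-identity = solve-∀

realise-formD : ∀ s → Representation (2 ^ (3 + s) * oddPart formD) (3 + s + cost formD)
realise-formD s = rep-cast (rep-scale s (((rep-pow 2 ⊕ʳ rep-two) ⊗ʳ rep-six) ⊗ʳ (rep-pow 3 ⊕ʳ rep-two)))
                           (value (2 ^ s)) (copies-identity s)
  where
  value : ∀ S → S * 1080 ≡ 2 * (2 * (2 * S)) * 135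
  value = solve-∀
  copies-identity : ∀ s → s + 12 ≡ 3 + s + 9
  copies-identity = solve-∀

representation₁ : ∀ {m n} → Form₁ m n → Representation n (m + 1)
representation₁ {m} (inj₁ refl) = rep-cast (rep-pow m) (cong (2 ^_) (+-comm 1 m)) (+-comm 1 m)
representation₁ (inj₂ (zero , () , _))
representation₁ (inj₂ (suc s , _ , s<m , refl)) with <⇒≡+suc s<m
... | a , refl = rep-cast (realise-bin s a) (bin-value s a) (identity s a)
  where
  identity : ∀ s a → suc s + (2 + a) ≡ suc s + suc a + 1
  identity = solve-∀

representation₂ : ∀ {m n} → Form₂ m n → Representation n (m + 2)
representation₂ (inj₁ (_ , zero , _ , _ , () , _))
representation₂ (inj₁ (m₂ , suc s , m₂<m , s<m₂ , _ , refl)) with <⇒≡+suc s<m₂ | <⇒≡+suc m₂<m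
... | x , refl | y , refl = rep-cast (realise-formA s x y) (formA-value s x y) (identity s x y)
  where
  identity : ∀ s x y → suc s + (4 + (x + y)) ≡ suc s + suc x + suc y + 2
  identity = solve-∀
representation₂ (inj₂ (inj₁ (_ , _ , zero , _ , _ , _ , () , _)))
representation₂ (inj₂ (inj₁ (_ , _ , suc zero , _ , _ , _ , s≤s () , _)))
representation₂ (inj₂ (inj₁ (m₂ , m₃ , suc (suc s) , m₂<m , m₃<m₂ , m₄<m₃ , _ , balance , refl)))
  with <⇒≡+suc m₄<m₃ | <⇒≡+suc m₃<m₂ | <⇒≡+suc m₂<m
... | x , refl | y , refl | z , refl
  with suc-injective (+-cancel-middle (2 + s + suc x + suc y) (suc z) (2 + s) (suc x) balance)
... | refl = rep-cast (realise-formB s x y) (formB-value (2 + s) x y) (identity s x y)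
  where
  identity : ∀ s x y → 2 + s + (5 + (x + (x + y))) ≡ 2 + s + suc x + suc y + suc x + 2
  identity = solve-∀
representation₂ {m} (inj₂ (inj₂ (inj₁ (m₂ , m₂+3≤m , 6≤m₂+3 , refl))))
  with m≤n⇒∃[o]m+o≡n (+-cancelʳ-≤ 3 3 m₂ 6≤m₂+3)
... | s , refl with m≤n⇒∃[o]m+o≡n (subst (_≤ m) (sym (+-comm 3 (3 + s))) m₂+3≤m)
... | x , refl = rep-cast (realise-formC s x) (formC-value s x) (identity s x)
  where
  identity : ∀ s x → 2 + s + (6 + x) ≡ 6 + s + x + 2
  identity = solve-∀
representation₂ (inj₂ (inj₂ (inj₂ (10≤m , refl)))) with m≤n⇒∃[o]m+o≡n 10≤m
... | s , refl = rep-cast (realise-formD s) (formD-value s) (identity s)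
  where
  identity : ∀ s → 3 + s + 9 ≡ 10 + s + 2
  identity = solve-∀

Between : ℕ → Set
Between r = ∃ λ u → 2 ^ u < r × r < 2 ^ suc u

between⇒≢2^ : ∀ {r} j → Between r → r ≢ 2 ^ j
between⇒≢2^ j (u , lo , hi) refl = <⇒≱ (2^-cancel-< u j lo) (≤-pred (2^-cancel-< j (suc u) hi))

between-+ : ∀ u {t} → 0 < t → t < 2 ^ u → Between (2 ^ u + t)
between-+ u {t} t>0 t<2^u =
  u , m<m+n (2 ^ u) t>0 , subst (2 ^ u + t <_) (sym (2^suc≡ u)) (+-monoʳ-< (2 ^ u) t<2^u)

2^+2^< : ∀ {b c} → c < b → 2 ^ b + 2 ^ c < 2 ^ suc b
2^+2^< {b} {c} c<b =
  subst (2 ^ b + 2 ^ c <_) (sym (2^suc≡ b)) (+-monoʳ-< (2 ^ b) (^-monoʳ-< 2 ≤-refl c<b))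

between-formC : ∀ p q → suc q ≤ p → Between (2 ^ p + 2 ^ suc q + 2 ^ q)
between-formC p q sq≤p with m≤n⇒m<n∨m≡n sq≤p
... | inj₁ sq<p = subst Between (sym (+-assoc (2 ^ p) (2 ^ suc q) (2 ^ q)))
  (between-+ p (≤-trans (2^>0 (suc q)) (m≤m+n _ _)) (<-≤-trans (2^+2^< (n<1+n q)) (^-monoʳ-≤ 2 sq<p)))
... | inj₂ refl = subst Between (cong (_+ 2 ^ q) (2^suc≡ (suc q)))
  (between-+ (2 + q) (2^>0 q) (^-monoʳ-< 2 ≤-refl (≤-trans (n<1+n q) (n≤1+n (suc q)))))

form₁⇒power : ∀ {m n} → Form₁ m n → ∃ λ j → n ≡ 2 ^ m + 2 ^ j
form₁⇒power {m} (inj₁ n≡) = m , trans n≡ (trans (cong (2 ^_) (+-comm m 1)) (2^suc≡ m))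
form₁⇒power (inj₂ (m′ , _ , _ , n≡)) = m′ , n≡

form₂⇒between : ∀ {m n} → Form₂ m n → ∃ λ r → n ≡ 2 ^ m + r × Between r
form₂⇒between {m} (inj₁ (m₂ , m₃ , _ , m₃<m₂ , _ , n≡)) =
  _ , trans n≡ (+-assoc (2 ^ m) (2 ^ m₂) (2 ^ m₃)) , between-+ m₂ (2^>0 m₃) (^-monoʳ-< 2 ≤-refl m₃<m₂)
form₂⇒between {m} (inj₂ (inj₁ (m₂ , m₃ , m₄ , _ , m₃<m₂ , m₄<m₃ , _ , _ , n≡))) =
  _ , trans n≡ (regroup (2 ^ m) (2 ^ m₂) (2 ^ m₃) (2 ^ m₄)) ,
  between-+ m₂ (≤-trans (2^>0 m₃) (m≤m+n _ _)) (<-≤-trans (2^+2^< m₄<m₃) (^-monoʳ-≤ 2 m₃<m₂))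
  where
  regroup : ∀ a b c d → a + b + c + d ≡ a + (b + (c + d))
  regroup = solve-∀
form₂⇒between (inj₂ (inj₂ (inj₁ (zero , _ , s≤s (s≤s (s≤s ())) , _))))
form₂⇒between {m} (inj₂ (inj₂ (inj₁ (suc q , m₂+3≤m , _ , n≡)))) =
  _ , trans n≡ (regroup (2 ^ m) (2 ^ (m ∸ 3)) (2 ^ suc q) (2 ^ q)) ,
  between-formC (m ∸ 3) q (m+n≤o⇒m≤o∸n (suc q) m₂+3≤m)
  where
  regroup : ∀ a b c d → a + b + c + d ≡ a + (b + c + d)
  regroup = solve-∀
form₂⇒between (inj₂ (inj₂ (inj₂ (10≤m , n≡)))) with m≤n⇒∃[o]m+o≡n 10≤m
... | s , refl = _ , trans n≡ (regroup (2 ^ (10 + s)) (2 ^ (5 + s)) (2 ^ (4 + s)) (2 ^ (3 + s))) ,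
  between-+ (5 + s) (≤-trans (2^>0 (4 + s)) (m≤m+n _ _)) (2^+2^< (n<1+n (3 + s)))
  where
  regroup : ∀ a b c d → a + b + c + d ≡ a + (b + (c + d))
  regroup = solve-∀

form₂⇒¬form₁ : ∀ {m n} → Form₂ m n → ¬ Form₁ m n
form₂⇒¬form₁ {m} form₂ form₁ with form₂⇒between form₂ | form₁⇒power form₁
... | r , n≡ , between | j , n≡′ = between⇒≢2^ j between (+-cancelˡ-≡ (2 ^ m) r (2 ^ j) (trans (sym n≡) n≡′))

-- Optimality

shaped-of-representation : ∀ {m n} j → j ≤ 2 → 2 ^ m < n → Representation n (m + j) → Shaped (m + j) n
shaped-of-representation {m} j j≤2 lo (e , refl , copies≡) =
  subst (λ k → Shaped k (eval e)) copies≡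
        (shaped-of-efficient e (subst (λ k → Efficient k (eval e)) (sym copies≡) (efficient-below {m} j j≤2 lo)))

form₁-of-optimal : ∀ {m n} → 2 ^ m < n → ‖ n ‖₂≡ (m + 1) → Form₁ m n
form₁-of-optimal lo (r , _) = form₁-of-shaped lo (shaped-of-representation 1 (s≤s z≤n) lo r)

optimal-of-form₁ : ∀ {m n} → 2 ^ m < n → Form₁ m n → ‖ n ‖₂≡ (m + 1)
optimal-of-form₁ {m} lo form₁ =
  representation₁ form₁ , λ e eval≡ → copies-lower-bound e (subst (2 ^ m <_) (sym eval≡) lo)

form₂-of-optimal : ∀ {m n} → 2 ^ m < n → n ≤ 2 ^ (m + 1) → ‖ n ‖₂≡ (m + 2) → Form₂ m n
form₂-of-optimal {m} lo hi (r , minimal) =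
  form₂-of-shaped hi ¬form₁ (shaped-of-representation 2 ≤-refl lo r)
  where
  ¬form₁ : ¬ Form₁ m _
  ¬form₁ form₁ with representation₁ form₁
  ... | e , eval≡ , copies≡ =
    <⇒≱ (+-monoʳ-< m ≤-refl) (subst (m + 2 ≤_) copies≡ (minimal e eval≡))

optimal-of-form₂ : ∀ {m n} → 2 ^ m < n → Form₂ m n → ‖ n ‖₂≡ (m + 2)
optimal-of-form₂ {m} {n} lo form₂ = representation₂ form₂ , minimal
  where
  minimal : (e : Expr) → eval e ≡ n → m + 2 ≤ copies e
  minimal e eval≡ with m + 2 ≤? copies e
  ... | yes enough = enough
  ... | no  short  = contradiction
    (form₁-of-shaped lo (shaped-of-representation 1 (s≤s z≤n) lo (e , eval≡ , exactly)))
    (form₂⇒¬form₁ form₂)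
    where
    exactly : copies e ≡ m + 1
    exactly = ≤-antisym (≤-pred (subst (suc (copies e) ≤_) (+-suc m 1) (≰⇒> short)))
                        (copies-lower-bound e (subst (2 ^ m <_) (sym eval≡) lo))

theorem1p2 : (n m : ℕ) → 2 ∣ n → 0 < n → 2 ^ m < n → n ≤ 2 ^ (m + 1) →
    ((‖ n ‖₂≡ (m + 1)) ⇔
      (n ≡ 2 ^ (m + 1)
        ⊎ Σ ℕ (λ m′ → 1 ≤ m′ × m′ < m × n ≡ 2 ^ m + 2 ^ m′)))
    × ((‖ n ‖₂≡ (m + 2)) ⇔
      (Σ ℕ (λ m₂ → Σ ℕ (λ m₃ →
          m₂ < m × m₃ < m₂ × 1 ≤ m₃ × n ≡ 2 ^ m + 2 ^ m₂ + 2 ^ m₃))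
        ⊎ (Σ ℕ (λ m₂ → Σ ℕ (λ m₃ → Σ ℕ (λ m₄ →
            m₂ < m × m₃ < m₂ × m₄ < m₃ × 2 ≤ m₄ × m + m₄ ≡ m₂ + m₃
              × n ≡ 2 ^ m + 2 ^ m₂ + 2 ^ m₃ + 2 ^ m₄)))
        ⊎ (Σ ℕ (λ m₂ → m₂ + 3 ≤ m × 6 ≤ m₂ + 3
              × n ≡ 2 ^ m + 2 ^ (m ∸ 3) + 2 ^ m₂ + 2 ^ (m₂ ∸ 1))
        ⊎ (10 ≤ m × n ≡ 2 ^ m + 2 ^ (m ∸ 5) + 2 ^ (m ∸ 6) + 2 ^ (m ∸ 7))))))
theorem1p2 n m _ _ lo hi =
  mk⇔ (form₁-of-optimal lo) (optimal-of-form₁ lo) ,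
  mk⇔ (form₂-of-optimal lo hi) (optimal-of-form₂ lo)
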